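{- For every integer $d \ge 3$ there is a constant $C_d$ such that for every $h \ge 0$, the partial order $\mathcal{T}^h$ (with $n = 2^{h+1}-1$ elements) has a $d$-hitting family of schedules of size at most $C_d \, n^{d-2}$ (i.e. of size $O(n^{d-2})$).
   Context: $\mathcal{T}^h$ is the partial order on the set $\{0,1\}^{\le h}$ of binary strings of length at most $h$, where $x \le y$ iff $x$ is a prefix of $y$ (the complete binary tree of height $h$); it has $n = 2^{h+1}-1$ elements. A schedule of a finite partial order $(P,\le)$ is a linear extension of it. A $d$-tuple $(a_1,\dots,a_d)$ of distinct elements of $P$ is admissible if for all $i<j$ either $a_i \le a_j$ or $a_i,a_j$ are incomparable. A schedule hits $(a_1,\dots,a_d)$ if its restriction to $\{a_1,\dots,a_d\}$ is the sequence $a_1,\dots,a_d$. A family of schedules is $d$-hitting if every admissible $d$-tuple is hit by some schedule in the family. -}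

module Defs where

open import Data.Bool using (Bool)
open import Data.Nat using (ℕ; _≤_; _<_; _^_; _∸_; _*_)
open import Data.List using (List; length; _++_)
open import Data.List.Membership.Propositional using (_∈_)
open import Data.List.Relation.Unary.Unique.Propositional using (Unique)
open import Data.Fin using (Fin) renaming (_<_ to _<ᶠ_)
open import Data.Product using (Σ; ∃; ∃-syntax; _×_; proj₁)
open import Data.Nat using (_+_)
open import Data.Sum using (_⊎_)
open import Relation.Nullary using (¬_)
open import Relation.Binary.PropositionalEquality using (_≡_; _≢_)

-- Elements of 𝒯^h: binary strings of length at most h.
Node : ℕ → Set
Node h = Σ (List Bool) (λ x → length x ≤ h)

_≼_ : {h : ℕ} → Node h → Node h → Set
x ≼ y = ∃[ z ] (proj₁ x ++ z ≡ proj₁ y)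

size : ℕ → ℕ
size h = 2 ^ (h + 1) ∸ 1

Before : {A : Set} → List A → A → A → Set
Before s a b = ∃[ xs ] ∃[ ys ] (s ≡ xs ++ ys × a ∈ xs × b ∈ ys)

record Schedule (h : ℕ) : Set where
  field
    order    : List (Node h)
    unique   : Unique order
    complete : (x : Node h) → x ∈ order
    monotone : (x y : Node h) → x ≼ y → x ≢ y → Before order x y
open Schedule public

Distinct : {h d : ℕ} → (Fin d → Node h) → Set
Distinct {d = d} a = (i j : Fin d) → i ≢ j → a i ≢ a j

Admissible : {h d : ℕ} → (Fin d → Node h) → Set
Admissible {d = d} a =
  Distinct a ×
  ((i j : Fin d) → i <ᶠ j →
     (a i ≼ a j) ⊎ (¬ (a i ≼ a j) × ¬ (a j ≼ a i)))

-- A schedule hits the tuple if its restriction to {a_1..a_d} is a_1,...,a_d.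
Hits : {h d : ℕ} → Schedule h → (Fin d → Node h) → Set
Hits {d = d} s a = (i j : Fin d) → i <ᶠ j → Before (order s) (a i) (a j)

Hitting : (h d : ℕ) → List (Schedule h) → Set
Hitting h d F = (a : Fin d → Node h) → Admissible a →
  ∃[ s ] (s ∈ F × Hits s a)

-- A schedule is determined by pivots p₁, …, p_k (k = d - 2) and a preferred
-- child b: walk down the root-to-pᵢ paths for i = 1, …, k, then traverse the
-- whole tree in preorder visiting child b before child (not b), and keep only
-- the first visit of every node. Each part of this walk visits a node after its
-- ancestors, so the result is a linear extension. An admissible tuple
-- (a₁, …, a_d) is hit by the schedule with pivots a₁, …, a_{d-2} and with b
-- chosen so that the preorder puts a_{d-1} before a_d: no later aⱼ is an
-- ancestor of aᵢ, so aᵢ is first visited on its own path, before any later aⱼ.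
-- This gives 2 · n^{d-2} schedules.
module Submission where

open import Defs
open import Data.Nat using (ℕ; _≤_; _*_; _^_; _∸_)
open import Data.List using (List; length)
open import Data.Product using (∃-syntax; _×_)

open import Data.Bool using (Bool; true; false; not)
import Data.Bool as Bool
open import Data.Bool.Properties using (not-¬; ¬-not)
open import Data.Nat using (zero; suc; _+_; z≤n; s≤s)
open import Data.Nat.Properties using (*-comm; ≤-trans; ≤-refl; ≤-reflexive; ≤-irrelevant)
open import Data.Nat.Solver using (module +-*-Solver)
open import Data.List using ([]; _∷_; _++_; map; filter; deduplicate; inits; tabulate; cartesianProductWith)
open import Data.List.Properties
  using ( ≡-dec; filter-++; ++-assoc; ++-cancelˡ; ++-conicalˡ; ++-identityʳ
        ; length-++; length-++-≤ˡ; length-map; map-++; ∷-injectiveˡ; ∷-injectiveʳ)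
open import Data.List.Membership.Propositional using (_∈_; _∉_)
open import Data.List.Membership.Propositional.Properties
  using ( ∈-++⁺ˡ; ∈-++⁺ʳ; ∈-++⁻; ∈-map⁺; ∈-map⁻; ∈-filter⁺; ∈-deduplicate⁺
        ; ∈-cartesianProductWith⁺)
open import Data.List.Relation.Unary.All as All using (All; []; _∷_)
open import Data.List.Relation.Unary.All.Properties using (++⁺; map⁺; deduplicate⁺)
open import Data.List.Relation.Unary.Any as Any using (here; there)
import Data.List.Relation.Unary.Any.Properties as Any
open import Data.List.Relation.Unary.Unique.Propositional using (Unique)
import Data.List.Relation.Unary.Unique.Propositional.Properties as Unique
import Data.List.Relation.Unary.Unique.DecPropositional.Properties as UniqueDec
open import Data.Fin using (Fin; fromℕ; inject₁) renaming (zero to fzero; suc to fsuc; _<_ to _<ᶠ_)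
open import Data.Fin.Properties using (<⇒≢; ≤̄⇒inject₁<)
open import Data.Product using (_,_; proj₁; proj₂)
open import Data.Sum using (inj₁; inj₂; [_,_]′)
open import Function using (_∘_)
open import Function.Definitions using (Injective)
open import Relation.Nullary using (¬_; yes; no; ¬?; contradiction)
open import Relation.Unary using (Decidable)
open import Relation.Binary.Definitions using (DecidableEquality)
open import Relation.Binary.PropositionalEquality
  using (_≡_; _≢_; refl; sym; trans; cong; cong₂; subst; module ≡-Reasoning)

module _ {A B : Set} where

  ∈-map⁻-injective : {f : A → B} → Injective _≡_ _≡_ f →
                     ∀ {x xs} → f x ∈ map f xs → x ∈ xs
  ∈-map⁻-injective f-inj = Any.map f-inj ∘ Any.map⁻

  map-++⁻ : (f : A → B) (L : List A) {xs ys : List B} → map f L ≡ xs ++ ys →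
            ∃[ L₁ ] ∃[ L₂ ] (L ≡ L₁ ++ L₂ × map f L₁ ≡ xs × map f L₂ ≡ ys)
  map-++⁻ f L        {[]}     refl = [] , L , refl , refl , refl
  map-++⁻ f (u ∷ L)  {_ ∷ xs} eq with map-++⁻ f L {xs} (∷-injectiveʳ eq)
  ... | L₁ , L₂ , refl , refl , refl = u ∷ L₁ , L₂ , refl , cong (_∷ _) (∷-injectiveˡ eq) , refl

  Before-map⁻ : {f : A → B} → Injective _≡_ _≡_ f →
                ∀ L {x y} → Before (map f L) (f x) (f y) → Before L x y
  Before-map⁻ {f} f-inj L (xs , ys , eq , fx∈xs , fy∈ys) with map-++⁻ f L {xs} {ys} eq
  ... | L₁ , L₂ , refl , refl , refl =
    L₁ , L₂ , refl , ∈-map⁻-injective f-inj fx∈xs , ∈-map⁻-injective f-inj fy∈ys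

length-cartesianProductWith : ∀ {A B C : Set} (f : A → B → C) (xs : List A) (ys : List B) →
  length (cartesianProductWith f xs ys) ≡ length xs * length ys
length-cartesianProductWith f []       ys = refl
length-cartesianProductWith f (x ∷ xs) ys = begin
  length (map (f x) ys ++ cartesianProductWith f xs ys)
    ≡⟨ length-++ (map (f x) ys) ⟩
  length (map (f x) ys) + length (cartesianProductWith f xs ys)
    ≡⟨ cong₂ _+_ (length-map (f x) ys) (length-cartesianProductWith f xs ys) ⟩
  length ys + length xs * length ys ∎
  where open ≡-Reasoning

module _ {A : Set} where

  Before-∷ : ∀ u {L} {x y : A} → Before L x y → Before (u ∷ L) x y
  Before-∷ u (xs , ys , refl , x∈xs , y∈ys) = u ∷ xs , ys , refl , there x∈xs , y∈ys

  Before-filter : {P : A → Set} (P? : Decidable P) → ∀ {L x y} →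
                  Before L x y → P x → P y → Before (filter P? L) x y
  Before-filter P? (xs , ys , refl , x∈xs , y∈ys) px py =
    filter P? xs , filter P? ys , filter-++ P? xs ys , ∈-filter⁺ P? x∈xs px , ∈-filter⁺ P? y∈ys py

  FirstBefore : List A → A → A → Set
  FirstBefore L x y = ∃[ xs ] ∃[ ys ] (L ≡ xs ++ ys × x ∈ xs × y ∉ xs × y ∈ ys)

  FirstBefore-++ˡ : ∀ zs {L} {x y : A} → y ∉ zs → FirstBefore L x y → FirstBefore (zs ++ L) x y
  FirstBefore-++ˡ zs y∉zs (xs , ys , refl , x∈xs , y∉xs , y∈ys) =
    zs ++ xs , ys , sym (++-assoc zs xs ys) , ∈-++⁺ʳ zs x∈xs ,
    [ y∉zs , y∉xs ]′ ∘ ∈-++⁻ zs , y∈ys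

  FirstBefore-++ʳ : ∀ zs {L} {x y : A} → FirstBefore L x y → FirstBefore (L ++ zs) x y
  FirstBefore-++ʳ zs (xs , ys , refl , x∈xs , y∉xs , y∈ys) =
    xs , ys ++ zs , ++-assoc xs ys zs , x∈xs , y∉xs , ∈-++⁺ˡ y∈ys

  -- deduplicate keeps the first occurrence of every element.
  Before-deduplicate : (_≟_ : DecidableEquality A) → ∀ {L x y} →
                       FirstBefore L x y → Before (deduplicate _≟_ L) x y
  Before-deduplicate _≟_ {x = x} {y} (xs , ys , refl , x∈xs , y∉xs , y∈ys) = go xs x∈xs y∉xs
    where
    go : ∀ zs → x ∈ zs → y ∉ zs → Before (deduplicate _≟_ (zs ++ ys)) x y
    go (u ∷ zs) (here refl) y∉ =
      u ∷ [] , _ , refl , here refl ,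
      ∈-filter⁺ (¬? ∘ (u ≟_)) (∈-deduplicate⁺ _≟_ (∈-++⁺ʳ zs y∈ys)) (y∉ ∘ here ∘ sym)
    go (u ∷ zs) (there x∈zs) y∉ with u ≟ x
    ... | yes refl = go (u ∷ zs) (here refl) y∉
    ... | no u≢x =
      Before-∷ u (Before-filter (¬? ∘ (u ≟_)) (go zs x∈zs (y∉ ∘ there)) u≢x (y∉ ∘ here ∘ sym))

FirstBefore-map : ∀ {A B : Set} {f : A → B} → Injective _≡_ _≡_ f →
                  ∀ {L x y} → FirstBefore L x y → FirstBefore (map f L) (f x) (f y)
FirstBefore-map {f = f} f-inj (xs , ys , refl , x∈xs , y∉xs , y∈ys) =
  map f xs , map f ys , map-++ f xs ys , ∈-map⁺ f x∈xs ,
  y∉xs ∘ ∈-map⁻-injective f-inj , ∈-map⁺ f y∈ys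

-- Binary strings and the prefix order

Bits : Set
Bits = List Bool

_≟_ : DecidableEquality Bits
_≟_ = ≡-dec Bool._≟_

open import Data.List.Membership.DecPropositional _≟_ using (_∈?_)

infix 4 _⊏_
data _⊏_ : Bits → Bits → Set where
  []⊏∷  : ∀ {c y} → [] ⊏ c ∷ y
  ∷⊏∷  : ∀ {c x y} → x ⊏ y → c ∷ x ⊏ c ∷ y

⊏-length : ∀ {x y} → x ⊏ y → length x ≤ length y
⊏-length []⊏∷     = z≤n
⊏-length (∷⊏∷ p) = s≤s (⊏-length p)

++⇒⊏ : ∀ {x y} z → x ++ z ≡ y → x ≢ y → x ⊏ y
++⇒⊏ {[]}    {[]}    z eq x≢y = contradiction refl x≢y
++⇒⊏ {[]}    {c ∷ y} z eq x≢y = []⊏∷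
++⇒⊏ {c ∷ x} {_ ∷ _} z refl x≢y = ∷⊏∷ (++⇒⊏ z refl (x≢y ∘ cong (c ∷_)))

prefix-antisym : ∀ {x y : Bits} z w → x ++ z ≡ y → y ++ w ≡ x → x ≡ y
prefix-antisym {x} z w refl eq = begin
  x       ≡⟨ ++-identityʳ x ⟨
  x ++ [] ≡⟨ cong (x ++_) z≡[] ⟩
  x ++ z  ∎
  where
  open ≡-Reasoning
  z≡[] : [] ≡ z
  z≡[] = sym (++-conicalˡ z w (sym (++-cancelˡ x [] (z ++ w)
           (trans (++-identityʳ x) (trans (sym eq) (++-assoc x z w))))))

∷∉[[]] : ∀ {c : Bool} {y : Bits} → c ∷ y ∉ [] ∷ []
∷∉[[]] (here ())
∷∉[[]] (there ())

∷∉map-∷ : ∀ {c c′ y} {D : List Bits} → c ≢ c′ → c ∷ y ∉ map (c′ ∷_) D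
∷∉map-∷ c≢c′ m with ∈-map⁻ _ m
... | _ , _ , eq = c≢c′ (∷-injectiveˡ eq)

∈-inits : (x : Bits) → x ∈ inits x
∈-inits []      = here refl
∈-inits (c ∷ x) = there (∈-map⁺ (c ∷_) (∈-inits x))

∈-inits⁻ : (x : Bits) {y : Bits} → y ∈ inits x → ∃[ z ] (y ++ z ≡ x)
∈-inits⁻ x       (here refl) = x , refl
∈-inits⁻ (c ∷ x) (there m) with ∈-map⁻ (c ∷_) m
... | y , y∈ , refl with ∈-inits⁻ x y∈
...   | z , eq = z , cong (c ∷_) eq

inits-bounded : (x : Bits) → All (λ y → length y ≤ length x) (inits x)
inits-bounded x = All.tabulate bound
  where
  bound : ∀ {y} → y ∈ inits x → length y ≤ length x
  bound {y} m with ∈-inits⁻ x m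
  ... | z , refl = length-++-≤ˡ y

⊏⇒FirstBefore-inits : ∀ a {x y} → x ⊏ y → y ∈ inits a → FirstBefore (inits a) x y
⊏⇒FirstBefore-inits []      ()       (here refl)
⊏⇒FirstBefore-inits (c ∷ a) ()       (here refl)
⊏⇒FirstBefore-inits (c ∷ a) x⊏y      (there m) with ∈-map⁻ (c ∷_) m
⊏⇒FirstBefore-inits (c ∷ a) []⊏∷      (there m) | y , y∈ , refl =
  [] ∷ [] , _ , refl , here refl , ∷∉[[]] , ∈-map⁺ (c ∷_) y∈
⊏⇒FirstBefore-inits (c ∷ a) (∷⊏∷ x⊏y) (there m) | y , y∈ , refl =
  FirstBefore-++ˡ ([] ∷ []) ∷∉[[]]
    (FirstBefore-map ∷-injectiveʳ (⊏⇒FirstBefore-inits a x⊏y y∈))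

-- Preorder traversal

children : Bool → List Bits → List Bits
children b D = map (b ∷_) D ++ map (not b ∷_) D

preorder : Bool → ℕ → List Bits
preorder b zero    = [] ∷ []
preorder b (suc h) = [] ∷ children b (preorder b h)

∈-children : ∀ b c {x D} → x ∈ D → c ∷ x ∈ children b D
∈-children b c {D = D} x∈D with c Bool.≟ b
... | yes refl = ∈-++⁺ˡ (∈-map⁺ (c ∷_) x∈D)
... | no c≢b rewrite ¬-not c≢b = ∈-++⁺ʳ (map (b ∷_) D) (∈-map⁺ (not b ∷_) x∈D)

FirstBefore-children : ∀ b c {D x y} → FirstBefore D x y → FirstBefore (children b D) (c ∷ x) (c ∷ y)
FirstBefore-children b c {D} fb with c Bool.≟ b
... | yes refl = FirstBefore-++ʳ _ (FirstBefore-map ∷-injectiveʳ fb)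
... | no c≢b rewrite ¬-not c≢b =
  FirstBefore-++ˡ (map (b ∷_) D) (∷∉map-∷ (not-¬ refl ∘ sym)) (FirstBefore-map ∷-injectiveʳ fb)

∈-preorder : ∀ b h {x} → length x ≤ h → x ∈ preorder b h
∈-preorder b zero    {[]}    _       = here refl
∈-preorder b (suc h) {[]}    _       = here refl
∈-preorder b (suc h) {c ∷ x} (s≤s p) = there (∈-children b c (∈-preorder b h p))

preorder-bounded : ∀ b h → All (λ x → length x ≤ h) (preorder b h)
preorder-bounded b zero    = z≤n ∷ []
preorder-bounded b (suc h) = z≤n ∷ ++⁺ (map⁺ (All.map s≤s IH)) (map⁺ (All.map s≤s IH))
  where
  IH : All (λ x → length x ≤ h) (preorder b h)
  IH = preorder-bounded b h

length-preorder : ∀ b h → suc (length (preorder b h)) ≡ 2 ^ (h + 1)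
length-preorder b zero    = refl
length-preorder b (suc h) = begin
  2 + length (map (b ∷_) D ++ map (not b ∷_) D)
    ≡⟨ cong (2 +_) (length-++ (map (b ∷_) D)) ⟩
  2 + (length (map (b ∷_) D) + length (map (not b ∷_) D))
    ≡⟨ cong₂ (λ m n → 2 + (m + n)) (length-map (b ∷_) D) (length-map (not b ∷_) D) ⟩
  2 + (length D + length D)
    ≡⟨ double-suc (length D) ⟩
  2 * suc (length D)
    ≡⟨ cong (2 *_) (length-preorder b h) ⟩
  2 * 2 ^ (h + 1) ∎
  where
  open ≡-Reasoning
  open +-*-Solver
  D : List Bits
  D = preorder b h
  double-suc : ∀ n → 2 + (n + n) ≡ 2 * suc n
  double-suc = solve 1 (λ n → con 2 :+ (n :+ n) := con 2 :* (con 1 :+ n)) refl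

-- x comes before y in the preorder traversal visiting child b first.
data Precedes (b : Bool) : Bits → Bits → Set where
  root   : ∀ {c y} → Precedes b [] (c ∷ y)
  branch : ∀ {x y} → Precedes b (b ∷ x) (not b ∷ y)
  below  : ∀ {c x y} → Precedes b x y → Precedes b (c ∷ x) (c ∷ y)

⊏⇒Precedes : ∀ b {x y} → x ⊏ y → Precedes b x y
⊏⇒Precedes b []⊏∷    = root
⊏⇒Precedes b (∷⊏∷ p) = below (⊏⇒Precedes b p)

incomparable⇒Precedes : ∀ x y → ¬ (∃[ z ] (x ++ z ≡ y)) → ¬ (∃[ z ] (y ++ z ≡ x)) →
                        ∃[ b ] Precedes b x y
incomparable⇒Precedes []      y       x⋠y y⋠x = contradiction (y , refl) x⋠y
incomparable⇒Precedes (c ∷ x) []      x⋠y y⋠x = contradiction (c ∷ x , refl) y⋠x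
incomparable⇒Precedes (c ∷ x) (c′ ∷ y) x⋠y y⋠x with c′ Bool.≟ c
... | no c′≢c rewrite ¬-not c′≢c = c , branch
... | yes refl =
  let b , p = incomparable⇒Precedes x y (λ (z , eq) → x⋠y (z , cong (c ∷_) eq))
                                        (λ (z , eq) → y⋠x (z , cong (c ∷_) eq))
  in b , below p

Precedes⇒FirstBefore : ∀ b h {x y} → Precedes b x y → length x ≤ h → length y ≤ h →
                       FirstBefore (preorder b h) x y
Precedes⇒FirstBefore b (suc h) (root {c}) _ (s≤s q) =
  [] ∷ [] , _ , refl , here refl , ∷∉[[]] , ∈-children b c (∈-preorder b h q)
Precedes⇒FirstBefore b (suc h) branch (s≤s p) (s≤s q) =
  [] ∷ map (b ∷_) D , map (not b ∷_) D , refl ,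
  there (∈-map⁺ (b ∷_) (∈-preorder b h p)) ,
  (λ { (there m) → ∷∉map-∷ (not-¬ refl ∘ sym) m }) ,
  ∈-map⁺ (not b ∷_) (∈-preorder b h q)
  where
  D : List Bits
  D = preorder b h
Precedes⇒FirstBefore b (suc h) (below {c} p) (s≤s lx) (s≤s ly) =
  FirstBefore-++ˡ ([] ∷ []) ∷∉[[]]
    (FirstBefore-children b c (Precedes⇒FirstBefore b h p lx ly))

visits : ∀ {h} → Bool → List (Node h) → List Bits
visits {h} b []       = preorder b h
visits     b (p ∷ ps) = inits (proj₁ p) ++ visits b ps

visits-bounded : ∀ {h} b (ps : List (Node h)) → All (λ x → length x ≤ h) (visits b ps)
visits-bounded {h} b []       = preorder-bounded b h
visits-bounded     b (p ∷ ps) =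
  ++⁺ (All.map (λ q → ≤-trans q (proj₂ p)) (inits-bounded (proj₁ p))) (visits-bounded b ps)

preorder⊆visits : ∀ {h} b (ps : List (Node h)) {x} → x ∈ preorder b h → x ∈ visits b ps
preorder⊆visits b []       m = m
preorder⊆visits b (p ∷ ps) m = ∈-++⁺ʳ (inits (proj₁ p)) (preorder⊆visits b ps m)

⊏⇒FirstBefore-visits : ∀ {h} b (ps : List (Node h)) {x y} → x ⊏ y → length y ≤ h →
                       FirstBefore (visits b ps) x y
⊏⇒FirstBefore-visits {h} b [] x⊏y ly =
  Precedes⇒FirstBefore b h (⊏⇒Precedes b x⊏y) (≤-trans (⊏-length x⊏y) ly) ly
⊏⇒FirstBefore-visits b (p ∷ ps) {y = y} x⊏y ly with y ∈? inits (proj₁ p)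
... | yes y∈ = FirstBefore-++ʳ (visits b ps) (⊏⇒FirstBefore-inits (proj₁ p) x⊏y y∈)
... | no  y∉ = FirstBefore-++ˡ (inits (proj₁ p)) y∉ (⊏⇒FirstBefore-visits b ps x⊏y ly)

proj₁-injective : ∀ {h} → Injective _≡_ _≡_ (proj₁ {A = Bits} {B = λ x → length x ≤ h})
proj₁-injective {x = x , p} {.x , q} refl = cong (x ,_) (≤-irrelevant p q)

module _ {h : ℕ} {R : List Bits} (R≤h : All (λ x → length x ≤ h) R) where

  map-proj₁-toList : map proj₁ (All.toList R≤h) ≡ R
  map-proj₁-toList = go R≤h
    where
    go : ∀ {R′} (R′≤h : All (λ x → length x ≤ h) R′) → map proj₁ (All.toList R′≤h) ≡ R′
    go []         = refl
    go (_ ∷ R′≤h) = cong (_ ∷_) (go R′≤h)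

  length-toList : length (All.toList R≤h) ≡ length R
  length-toList = trans (sym (length-map proj₁ (All.toList R≤h))) (cong length map-proj₁-toList)

  ∈-toList : (X : Node h) → proj₁ X ∈ R → X ∈ All.toList R≤h
  ∈-toList X m = ∈-map⁻-injective proj₁-injective (subst (proj₁ X ∈_) (sym map-proj₁-toList) m)

  Before-toList : {X Y : Node h} → Before R (proj₁ X) (proj₁ Y) → Before (All.toList R≤h) X Y
  Before-toList b = Before-map⁻ proj₁-injective _ (subst (λ L → Before L _ _) (sym map-proj₁-toList) b)

  Unique-toList : Unique R → Unique (All.toList R≤h)
  Unique-toList u = Unique.map⁻ (subst Unique (sym map-proj₁-toList) u)

schedule : ∀ {h} → List (Node h) → Bool → Schedule h
schedule {h} ps b = record
  { order    = All.toList R≤h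
  ; unique   = Unique-toList R≤h (UniqueDec.deduplicate-! _≟_ (visits b ps))
  ; complete = λ X → ∈-toList R≤h X
      (∈-deduplicate⁺ _≟_ (preorder⊆visits b ps (∈-preorder b h (proj₂ X))))
  ; monotone = λ X Y (z , eq) X≢Y → Before-toList R≤h (Before-deduplicate _≟_
      (⊏⇒FirstBefore-visits b ps (++⇒⊏ z eq (X≢Y ∘ proj₁-injective)) (proj₂ Y)))
  }
  where
  R≤h : All (λ x → length x ≤ h) (deduplicate _≟_ (visits b ps))
  R≤h = deduplicate⁺ _≟_ (visits-bounded b ps)

FirstBefore⇒Before-schedule : ∀ {h} (ps : List (Node h)) b {X Y : Node h} →
  FirstBefore (visits b ps) (proj₁ X) (proj₁ Y) → Before (order (schedule ps b)) X Y
FirstBefore⇒Before-schedule ps b fb =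
  Before-toList (deduplicate⁺ _≟_ (visits-bounded b ps)) (Before-deduplicate _≟_ fb)

-- The hitting family

pivots : ∀ {h k} → (Fin (suc (suc k)) → Node h) → List (Node h)
pivots a = tabulate (a ∘ inject₁ ∘ inject₁)

-- a (inject₁ (fromℕ k)) and a (fromℕ (suc k)) are the last two entries of a.
FirstBefore-visits-pivots : ∀ {h} b k (a : Fin (suc (suc k)) → Node h) →
  (∀ i j → i <ᶠ j → proj₁ (a j) ∉ inits (proj₁ (a i))) →
  FirstBefore (preorder b h) (proj₁ (a (inject₁ (fromℕ k)))) (proj₁ (a (fromℕ (suc k)))) →
  ∀ i j → i <ᶠ j → FirstBefore (visits b (pivots a)) (proj₁ (a i)) (proj₁ (a j))
FirstBefore-visits-pivots b zero a _ last fzero (fsuc fzero) _ = last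
FirstBefore-visits-pivots b zero a _ _ fzero        fzero        ()
FirstBefore-visits-pivots b zero a _ _ (fsuc fzero) fzero        ()
FirstBefore-visits-pivots b zero a _ _ (fsuc fzero) (fsuc fzero) (s≤s ())
FirstBefore-visits-pivots {h} b (suc k) a later∉ last fzero (fsuc j) _ =
  inits (proj₁ (a fzero)) , visits b (pivots (a ∘ fsuc)) , refl ,
  ∈-inits (proj₁ (a fzero)) , later∉ fzero (fsuc j) (s≤s z≤n) ,
  preorder⊆visits b (pivots (a ∘ fsuc)) (∈-preorder b h (proj₂ (a (fsuc j))))
FirstBefore-visits-pivots b (suc k) a later∉ last (fsuc i) (fsuc j) (s≤s i<j) =
  FirstBefore-++ˡ (inits (proj₁ (a fzero))) (later∉ fzero (fsuc j) (s≤s z≤n))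
    (FirstBefore-visits-pivots b k (a ∘ fsuc)
      (λ i j i<j → later∉ (fsuc i) (fsuc j) (s≤s i<j)) last i j i<j)

nodes : ∀ h → List (Node h)
nodes h = All.toList (preorder-bounded false h)

∈-nodes : ∀ h (X : Node h) → X ∈ nodes h
∈-nodes h X = ∈-toList (preorder-bounded false h) X (∈-preorder false h (proj₂ X))

length-nodes : ∀ h → length (nodes h) ≡ size h
length-nodes h = trans (length-toList (preorder-bounded false h)) (cong (_∸ 1) (length-preorder false h))

tuples : ∀ h → ℕ → List (List (Node h))
tuples h zero    = [] ∷ []
tuples h (suc k) = cartesianProductWith _∷_ (nodes h) (tuples h k)

length-tuples : ∀ h k → length (tuples h k) ≡ size h ^ k
length-tuples h zero    = refl
length-tuples h (suc k) =
  trans (length-cartesianProductWith _∷_ (nodes h) (tuples h k))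
        (cong₂ _*_ (length-nodes h) (length-tuples h k))

pivots∈tuples : ∀ {h} k (a : Fin (suc (suc k)) → Node h) → pivots a ∈ tuples h k
pivots∈tuples zero    a = here refl
pivots∈tuples {h} (suc k) a =
  ∈-cartesianProductWith⁺ _∷_ (∈-nodes h (a fzero)) (pivots∈tuples k (a ∘ fsuc))

family : ∀ h → ℕ → List (Schedule h)
family h k = cartesianProductWith schedule (tuples h k) (false ∷ true ∷ [])

length-family : ∀ h k → length (family h k) ≡ 2 * size h ^ k
length-family h k = begin
  length (family h k)                ≡⟨ length-cartesianProductWith schedule (tuples h k) _ ⟩
  length (tuples h k) * 2            ≡⟨ cong (_* 2) (length-tuples h k) ⟩
  size h ^ k * 2                     ≡⟨ *-comm (size h ^ k) 2 ⟩
  2 * size h ^ k                     ∎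
  where open ≡-Reasoning

family-hitting : ∀ h k → Hitting h (suc (suc k)) (family h k)
family-hitting h k a (distinct , admissible) =
  let b , last-two = choice in
  schedule (pivots a) b ,
  ∈-cartesianProductWith⁺ schedule (pivots∈tuples k a) (b∈bools b) ,
  λ i j i<j → FirstBefore⇒Before-schedule (pivots a) b
    (FirstBefore-visits-pivots b k a later∉
      (Precedes⇒FirstBefore b h last-two (proj₂ (a _)) (proj₂ (a _))) i j i<j)
  where
  b∈bools : ∀ b → b ∈ false ∷ true ∷ []
  b∈bools false = here refl
  b∈bools true  = there (here refl)

  later∉ : ∀ i j → i <ᶠ j → proj₁ (a j) ∉ inits (proj₁ (a i))
  later∉ i j i<j m with ∈-inits⁻ (proj₁ (a i)) m | admissible i j i<j
  ... | w , aj≼ai | inj₁ (z , ai≼aj) =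
    distinct i j (<⇒≢ i<j) (proj₁-injective (prefix-antisym z w ai≼aj aj≼ai))
  ... | w , aj≼ai | inj₂ (_ , aj⋠ai) = aj⋠ai (w , aj≼ai)

  penult<last : inject₁ (fromℕ k) <ᶠ fromℕ (suc k)
  penult<last = ≤̄⇒inject₁< ≤-refl

  choice : ∃[ b ] Precedes b (proj₁ (a (inject₁ (fromℕ k)))) (proj₁ (a (fromℕ (suc k))))
  choice with admissible _ _ penult<last
  ... | inj₁ (z , eq) =
    false , ⊏⇒Precedes false (++⇒⊏ z eq (distinct _ _ (<⇒≢ penult<last) ∘ proj₁-injective))
  ... | inj₂ (x⋠y , y⋠x) = incomparable⇒Precedes _ _ x⋠y y⋠x

claim2 : (d : ℕ) → 3 ≤ d → ∃[ C ] ((h : ℕ) →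
    ∃[ F ] (Hitting h d F × length F ≤ C * size h ^ (d ∸ 2)))
claim2 (suc (suc k)) _ =
  2 , λ h → family h k , family-hitting h k , ≤-reflexive (length-family h k)
claim2 (suc zero) (s≤s ())
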